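{- Let $\mathcal{P}=(P,\leq^\mathcal{P})$ be a finite colored poset with a fixed chain partition, let $\phi$ be a first-order formula of quantifier rank $q$, and let $p_1,\dots,p_j\in P$ with $j\ge 1$. In the $r$-local Hintikka game $\mathcal{G}_r(\mathcal{P},\phi)$ with initial position $\phi(p_1,\dots,p_j)$, every reachable game position $\psi(p_1,\dots,p_k)$ with $k>j$ satisfies $p_{j+1},\dots,p_k\in R^{D_{q-1}}_{r_{q-1}}(p_1,\dots,p_j)$.
   Context: $\mathcal{P}$ is colored by $\lambda:P\to\Lambda$ ($\Lambda$ finite) and has a chain partition $(C_1,\dots,C_w)$; $C(p)=C_j$ for $p\in C_j$. Digraphs may have labeled vertices and arcs and parallel arcs; $R^D_r(v_1,\dots,v_k)$ is the set of vertices reachable in $D$ from some $v_i$ by a directed path of length at most $r$. Put $r_s=3\cdot4^s-1$. Let $\tau_0(p)=\langle\lambda(p),j\rangle$ where $C(p)=C_j$. Given $\tau_s$, $D_s$ is the digraph on $P$ with vertex labels $\tau_s$ and arcs: for every $p\in P$ and $j\in\{1,\dots,w\}$, an arc labeled 'max' from $p$ to the topmost element of $C_j$, an arc labeled 'min' from $p$ to the bottommost element of $C_j$, and for every value $t\in\{\tau_s(q):q\in C_j\}$ an arc labeled 'up' from $p$ to the bottommost $p'\in C_j$ with $p'\ne p$, $\tau_s(p')=t$, $p\leq^\mathcal{P}p'$ (if it exists) and an arc labeled 'down' from $p$ to the topmost $p'\in C_j$ with $p'\ne p$, $\tau_s(p')=t$, $p'\leq^\mathcal{P}p$ (if it exists).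 Let $P_s(p)=R^{D_s}_{r_s}(p)$ and $\mathcal{A}_s(p)$ the structure formed by the labeled induced subdigraph $D_s[P_s(p)]$ rooted at $p$ with $\leq^\mathcal{P}$ restricted to $P_s(p)$; $\tau_{s+1}(p)$ is the isomorphism type of $\mathcal{A}_s(p)$. Hintikka game: positions $\psi(p_1,\dots,p_\ell)$ are subformulas with free variables assigned; the existential player moves at disjunctions and existential quantifiers, the universal player at conjunctions and universal quantifiers; a quantifier move $Qy.\psi'(p_1,\dots,p_i,y)$ leads to $\psi'(p_1,\dots,p_i,p)$. In the $r$-local game, for such a move with $i\ge1$ player $Q$ must choose $p\in R^{D_{q'}}_{r_{q'}-r_{q'-1}}(p_1,\dots,p_i)$ where $q'\ge1$ is the quantifier rank of $\psi'$, or $p\in R^{D_0}_{r_0}(p_1,\dots,p_i)$ if $\psi'$ is quantifier-free. -}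

module Defs where

open import Data.Nat using (ℕ; zero; suc; _*_; _∸_; _^_; _≤_; _<_; _⊔_)
open import Data.Fin using (Fin; toℕ)
open import Data.Vec using (Vec; lookup; _∷ʳ_)
open import Data.Vec.Membership.Propositional using (_∈_)
open import Data.Product using (Σ; ∃; _×_; _,_)
open import Data.Sum using (_⊎_)
open import Relation.Nullary using (¬_)
open import Relation.Binary.PropositionalEquality using (_≡_)
open import Relation.Binary.Structures using (IsPartialOrder)
open import Relation.Binary.Construct.Closure.ReflexiveTransitive using (Star)
open import Function.Bundles using (_⇔_)

-- Finite colored posets with a fixed chain partition.
-- P = Fin n, colours Λ = Fin colors, chains C_1..C_w indexed by Fin width.

record ColoredPoset : Set₁ where
  field
    n              : ℕ
    _≤P_           : Fin n → Fin n → Set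
    isPartialOrder : IsPartialOrder _≡_ _≤P_
    colors         : ℕ
    colour         : Fin n → Fin colors
    width          : ℕ
    chain          : Fin n → Fin width
    chain-total    : ∀ p p' → chain p ≡ chain p' → (p ≤P p') ⊎ (p' ≤P p)
    chain-nonempty : ∀ j → ∃ λ p → chain p ≡ j

r : ℕ → ℕ
r s = 3 * 4 ^ s ∸ 1

-- First-order formulas over colored posets (negation normal form),
-- with de Bruijn-style free variables Fin k; a quantifier binds the
-- new *last* variable (index k of Formula (suc k)).

data Formula (m : ℕ) (k : ℕ) : Set where
  eqF neqF   : Fin k → Fin k → Formula m k
  leqF nleqF : Fin k → Fin k → Formula m k
  colF ncolF : Fin m → Fin k → Formula m k
  _∧F_ _∨F_  : Formula m k → Formula m k → Formula m k
  ∃F ∀F      : Formula m (suc k) → Formula m k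

qr : ∀ {m k} → Formula m k → ℕ
qr (eqF _ _)   = 0
qr (neqF _ _)  = 0
qr (leqF _ _)  = 0
qr (nleqF _ _) = 0
qr (colF _ _)  = 0
qr (ncolF _ _) = 0
qr (φ ∧F ψ)    = qr φ ⊔ qr ψ
qr (φ ∨F ψ)    = qr φ ⊔ qr ψ
qr (∃F φ)      = suc (qr φ)
qr (∀F φ)      = suc (qr φ)

data ArcLabel : Set where
  maxA minA upA downA : ArcLabel

module _ (𝒫 : ColoredPoset) where
  open ColoredPoset 𝒫

  P : Set
  P = Fin n

  IsTop IsBottom : P → Set
  IsTop v    = ∀ u → chain u ≡ chain v → u ≤P v
  IsBottom v = ∀ u → chain u ≡ chain v → v ≤P u

  -- Arcs of the digraph built from a vertex labelling, where the labelling
  -- τ is represented by its kernel Eq (Eq u v  ⇔  τ u = τ v).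
  -- Between two vertices there is at most one arc of a given label, so
  -- arcs are a relation ArcLabel → P → P → Set.
  Arc : (P → P → Set) → ArcLabel → P → P → Set
  Arc Eq maxA  p v = IsTop v
  Arc Eq minA  p v = IsBottom v
  Arc Eq upA   p v = (¬ v ≡ p) × (p ≤P v) ×
    (∀ u → chain u ≡ chain v → ¬ u ≡ p → Eq u v → p ≤P u → v ≤P u)
  Arc Eq downA p v = (¬ v ≡ p) × (v ≤P p) ×
    (∀ u → chain u ≡ chain v → ¬ u ≡ p → Eq u v → u ≤P p → u ≤P v)

  data Reach (A : ArcLabel → P → P → Set) (S : P → Set) : ℕ → P → Set where
    here : ∀ {ρ v} → S v → Reach A S ρ v
    step : ∀ {ρ u v} (l : ArcLabel) → Reach A S ρ u → A l u v → Reach A S (suc ρ) v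

  record IsoAt (Eq : P → P → Set) (ρ : ℕ) (p p' : P) : Set where
    field
      f        : P → P
      root     : f p ≡ p'
      into     : ∀ u → Reach (Arc Eq) (_≡ p) ρ u → Reach (Arc Eq) (_≡ p') ρ (f u)
      inj      : ∀ u v → Reach (Arc Eq) (_≡ p) ρ u → Reach (Arc Eq) (_≡ p) ρ v →
                 f u ≡ f v → u ≡ v
      onto     : ∀ v' → Reach (Arc Eq) (_≡ p') ρ v' →
                 ∃ λ u → Reach (Arc Eq) (_≡ p) ρ u × f u ≡ v'
      labels   : ∀ u → Reach (Arc Eq) (_≡ p) ρ u → Eq u (f u)
      arcs     : ∀ l u v → Reach (Arc Eq) (_≡ p) ρ u → Reach (Arc Eq) (_≡ p) ρ v →
                 Arc Eq l u v ⇔ Arc Eq l (f u) (f v)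
      order    : ∀ u v → Reach (Arc Eq) (_≡ p) ρ u → Reach (Arc Eq) (_≡ p) ρ v →
                 (u ≤P v) ⇔ (f u ≤P f v)

  -- τ_s as its kernel: SameType s p p'  ⇔  τ_s(p) = τ_s(p')
  SameType : ℕ → P → P → Set
  SameType zero    p p' = (colour p ≡ colour p') × (chain p ≡ chain p')
  SameType (suc s) p p' = IsoAt (SameType s) (r s) p p'

  D : ℕ → ArcLabel → P → P → Set
  D s = Arc (SameType s)

  R : ℕ → ℕ → (P → Set) → P → Set
  R s ρ S v = Reach (D s) S ρ v

  record Pos : Set where
    constructor pos
    field
      k  : ℕ
      ψ  : Formula colors k
      ps : Vec P k

  LocalBall : ℕ → (P → Set) → P → Set
  LocalBall zero       S p = R 0 (r 0) S p
  LocalBall (suc q')   S p = R (suc q') (r (suc q') ∸ r q') S p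

  Local : ∀ {i} → Formula colors (suc i) → Vec P i → P → Set
  Local {i} ψ' v p = 1 ≤ i → LocalBall (qr ψ') (_∈ v) p

  data Move : Pos → Pos → Set where
    ∧-left  : ∀ {k} (φ ψ : Formula colors k) (v : Vec P k) → Move (pos k (φ ∧F ψ) v) (pos k φ v)
    ∧-right : ∀ {k} (φ ψ : Formula colors k) (v : Vec P k) → Move (pos k (φ ∧F ψ) v) (pos k ψ v)
    ∨-left  : ∀ {k} (φ ψ : Formula colors k) (v : Vec P k) → Move (pos k (φ ∨F ψ) v) (pos k φ v)
    ∨-right : ∀ {k} (φ ψ : Formula colors k) (v : Vec P k) → Move (pos k (φ ∨F ψ) v) (pos k ψ v)
    ∃-move  : ∀ {k} (ψ : Formula colors (suc k)) (v : Vec P k) (p : P) →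
              Local ψ v p → Move (pos k (∃F ψ) v) (pos (suc k) ψ (v ∷ʳ p))
    ∀-move  : ∀ {k} (ψ : Formula colors (suc k)) (v : Vec P k) (p : P) →
              Local ψ v p → Move (pos k (∀F ψ) v) (pos (suc k) ψ (v ∷ʳ p))

  Reachable : Pos → Pos → Set
  Reachable = Star Move

module Submission where

-- Write Q = q - 1 and r⁻(c) = r_{c-1} with the convention r_{-1} = 0.  A
-- quantifier move into a subformula of rank c adds a point at distance at
-- most r⁻(c+1) - r⁻(c) from the earlier points, along arcs of D_c.  Since
-- the labellings τ_s refine each other, every arc of D_c is an arc of D_Q
-- for c ≤ Q.  Hence the invariant
--   at a position χ(v):  qr χ ≤ q, v is nonempty, and every point of v lies
--   in R^{D_Q}_{budget (qr χ)}(p₁,…,p_j), where budget c = r_Q - r⁻(c),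
-- holds initially (budget q = 0) and is preserved by every move: connective
-- moves only lower the rank, and a quantifier move spends exactly
-- r⁻(c+1) - r⁻(c) of the budget (a telescoping identity).

open import Defs
open import Data.Nat using (ℕ; zero; suc; _+_; _≤_; _<_; _∸_; _≤′_; ≤′-reflexive; ≤′-step; z≤n; s≤s)
open import Data.Nat.Properties
open import Data.Fin using (Fin; toℕ)
open import Data.Vec using (Vec; []; _∷_; _∷ʳ_; lookup)
open import Data.Vec.Relation.Unary.Any using (here; there)
open import Data.Vec.Membership.Propositional using (_∈_)
open import Data.Vec.Membership.Propositional.Properties using (∈-lookup)
open import Data.Product using (_,_)
open import Data.Sum using (_⊎_; inj₁; inj₂)
open import Relation.Binary.PropositionalEquality using (_≡_; refl; sym; cong; subst; module ≡-Reasoning)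
open import Relation.Binary.Construct.Closure.ReflexiveTransitive using (ε; _◅_)

r-mono : ∀ {m n} → m ≤ n → r m ≤ r n
r-mono m≤n = ∸-monoˡ-≤ 1 (*-monoʳ-≤ 3 (^-monoʳ-≤ 4 m≤n))

-- r⁻ c = r_{c-1}, with r_{-1} = 0: the radius already spent when the
-- remaining formula has rank c.
r⁻ : ℕ → ℕ
r⁻ zero    = 0
r⁻ (suc c) = r c

r⁻-mono : ∀ {c c'} → c ≤ c' → r⁻ c ≤ r⁻ c'
r⁻-mono {zero}  _         = z≤n
r⁻-mono (s≤s c≤c') = r-mono c≤c'

telescope : ∀ {a b c} → c ≤ b → b ≤ a → (b ∸ c) + (a ∸ b) ≡ a ∸ c
telescope {a} {b} {c} c≤b b≤a = begin
  (b ∸ c) + (a ∸ b)   ≡⟨ +-comm (b ∸ c) (a ∸ b) ⟩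
  (a ∸ b) + (b ∸ c)   ≡⟨ sym (+-∸-assoc (a ∸ b) c≤b) ⟩
  ((a ∸ b) + b) ∸ c   ≡⟨ cong (_∸ c) (m∸n+n≡m b≤a) ⟩
  a ∸ c               ∎
  where open ≡-Reasoning

∈-∷ʳ : ∀ {A : Set} {k} {x p : A} (v : Vec A k) → x ∈ (v ∷ʳ p) → x ∈ v ⊎ x ≡ p
∈-∷ʳ []       (here x≡p) = inj₂ x≡p
∈-∷ʳ (y ∷ ys) (here x≡y) = inj₁ (here x≡y)
∈-∷ʳ (y ∷ ys) (there x∈) with ∈-∷ʳ ys x∈
... | inj₁ x∈ys = inj₁ (there x∈ys)
... | inj₂ x≡p  = inj₂ x≡p

module Reachability (𝒫 : ColoredPoset) where

  reach-mono : ∀ {A S ρ ρ' v} → ρ ≤ ρ' → Reach 𝒫 A S ρ v → Reach 𝒫 A S ρ' v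
  reach-mono _         (here v∈S)   = here v∈S
  reach-mono (s≤s ρ≤ρ') (step l x a) = step l (reach-mono ρ≤ρ' x) a

  reach-arcs : ∀ {A A' S ρ v} → (∀ l u w → A l u w → A' l u w) →
               Reach 𝒫 A S ρ v → Reach 𝒫 A' S ρ v
  reach-arcs A⊆A' (here v∈S)   = here v∈S
  reach-arcs A⊆A' (step l x a) = step l (reach-arcs A⊆A' x) (A⊆A' _ _ _ a)

  reach-trans : ∀ {A S T ρ₁ ρ₂ v} → (∀ x → S x → Reach 𝒫 A T ρ₁ x) →
                Reach 𝒫 A S ρ₂ v → Reach 𝒫 A T (ρ₂ + ρ₁) v
  reach-trans {ρ₁ = ρ₁} {ρ₂} S⊆ball (here v∈S) = reach-mono (m≤n+m ρ₁ ρ₂) (S⊆ball _ v∈S)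
  reach-trans S⊆ball (step l x a) = step l (reach-trans S⊆ball x) a

module Refinement (𝒫 : ColoredPoset) where

  -- τ_{s+1} refines τ_s: isomorphic rooted structures have isomorphic,
  -- hence τ_s-equal, roots.
  refine : ∀ s {u v} → SameType 𝒫 (suc s) u v → SameType 𝒫 s u v
  refine s {u} iso = subst (SameType 𝒫 s u) (IsoAt.root iso) (IsoAt.labels iso u (here refl))

  -- Consequently D_s ⊆ D_{s+1}: max/min arcs do not depend on the labels,
  -- and the minimality condition of an up/down arc only quantifies over
  -- fewer competitors when the labelling gets finer.
  arc-suc : ∀ s l u v → D 𝒫 s l u v → D 𝒫 (suc s) l u v
  arc-suc s maxA  u v a = a
  arc-suc s minA  u v a = a
  arc-suc s upA   u v (v≢u , u≤v , least) =
    v≢u , u≤v , λ w w∈C w≢u w≈v u≤w → least w w∈C w≢u (refine s w≈v) u≤w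
  arc-suc s downA u v (v≢u , v≤u , greatest) =
    v≢u , v≤u , λ w w∈C w≢u w≈v w≤u → greatest w w∈C w≢u (refine s w≈v) w≤u

  arc-mono : ∀ {s s'} → s ≤′ s' → ∀ l u v → D 𝒫 s l u v → D 𝒫 s' l u v
  arc-mono (≤′-reflexive refl) l u v a = a
  arc-mono (≤′-step s≤′s')     l u v a = arc-suc _ l u v (arc-mono s≤′s' l u v a)

module Locality (𝒫 : ColoredPoset) (q : ℕ) {j : ℕ} (roots : Vec (P 𝒫) j) where
  open ColoredPoset 𝒫
  open Reachability 𝒫
  open Refinement 𝒫

  Q : ℕ
  Q = q ∸ 1

  -- Radius still available when the remaining formula has rank c.
  budget : ℕ → ℕ
  budget c = r Q ∸ r⁻ c

  budget-anti : ∀ {c c'} → c ≤ c' → budget c' ≤ budget c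
  budget-anti c≤c' = ∸-monoʳ-≤ (r Q) (r⁻-mono c≤c')

  -- A quantifier move into a subformula of rank c ≤ Q chooses a point at
  -- distance r⁻(c+1) - r⁻(c) in D_Q (definitionally the radius of the
  -- local ball, which is taken in D_c ⊆ D_Q; the split on c lets both
  -- radii compute).
  local-ball : ∀ {S p} c → c ≤ Q → LocalBall 𝒫 c S p → R 𝒫 Q (r⁻ (suc c) ∸ r⁻ c) S p
  local-ball zero    c≤Q x = reach-arcs (arc-mono (≤⇒≤′ c≤Q)) x
  local-ball (suc c) c≤Q x = reach-arcs (arc-mono (≤⇒≤′ c≤Q)) x

  spend : ∀ c → suc c ≤ q → (r⁻ (suc c) ∸ r⁻ c) + budget (suc c) ≡ budget c
  spend c c<q = telescope (r⁻-mono (n≤1+n c)) (r-mono (suc[m]≤n⇒m≤pred[n] c<q))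

  Within : ∀ {k} → ℕ → Vec (P 𝒫) k → Set
  Within c v = ∀ x → x ∈ v → R 𝒫 Q (budget c) (_∈ roots) x

  record Inv (a : Pos 𝒫) : Set where
    constructor inv
    field
      rank≤q   : qr (Pos.ψ a) ≤ q
      nonempty : 1 ≤ Pos.k a
      within   : Within (qr (Pos.ψ a)) (Pos.ps a)

  -- Moving to a subformula of no larger rank keeps the points and only
  -- enlarges the budget.
  subformula : ∀ {k} {χ φ : Formula colors k} {v} → qr φ ≤ qr χ →
               Inv (pos k χ v) → Inv (pos k φ v)
  subformula φ≤χ (inv χ≤q k≥1 within) =
    inv (≤-trans φ≤χ χ≤q) k≥1 (λ x x∈v → reach-mono (budget-anti φ≤χ) (within x x∈v))

  -- A quantifier move into ψ: the old points keep their (larger) budget,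
  -- and the new point p is within the move's distance of the old points,
  -- hence within budget (qr ψ) of the roots.
  quantifier : ∀ {k} (ψ : Formula colors (suc k)) (v : Vec (P 𝒫) k) (p : P 𝒫) →
               Local 𝒫 ψ v p → suc (qr ψ) ≤ q → 1 ≤ k → Within (suc (qr ψ)) v →
               Inv (pos (suc k) ψ (v ∷ʳ p))
  quantifier ψ v p local ψ<q k≥1 within =
    inv (≤-trans (n≤1+n (qr ψ)) ψ<q) (s≤s z≤n) within′
    where
    within′ : Within (qr ψ) (v ∷ʳ p)
    within′ x x∈ with ∈-∷ʳ v x∈
    ... | inj₁ x∈v  = reach-mono (budget-anti (n≤1+n (qr ψ))) (within x x∈v)
    ... | inj₂ refl = subst (λ ρ → R 𝒫 Q ρ (_∈ roots) p) (spend (qr ψ) ψ<q)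
                        (reach-trans within (local-ball (qr ψ) (suc[m]≤n⇒m≤pred[n] ψ<q) (local k≥1)))

  preserve : ∀ {a b} → Move 𝒫 a b → Inv a → Inv b
  preserve (∧-left  φ ψ v) = subformula (m≤m⊔n (qr φ) (qr ψ))
  preserve (∧-right φ ψ v) = subformula (m≤n⊔m (qr φ) (qr ψ))
  preserve (∨-left  φ ψ v) = subformula (m≤m⊔n (qr φ) (qr ψ))
  preserve (∨-right φ ψ v) = subformula (m≤n⊔m (qr φ) (qr ψ))
  preserve (∃-move ψ v p local) (inv ψ<q k≥1 within) = quantifier ψ v p local ψ<q k≥1 within
  preserve (∀-move ψ v p local) (inv ψ<q k≥1 within) = quantifier ψ v p local ψ<q k≥1 within

  preserve⋆ : ∀ {a b} → Reachable 𝒫 a b → Inv a → Inv b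
  preserve⋆ ε        I = I
  preserve⋆ (m ◅ ms) I = preserve⋆ ms (preserve m I)

-- Every point of a reachable position (in particular each p_i with i ≥ j)
-- lies within budget of the roots, and the budget never exceeds r_{q-1}.
lemma4p1 : (𝒫 : ColoredPoset) (q j : ℕ) (φ : Formula (ColoredPoset.colors 𝒫) j) →
    qr φ ≡ q → 1 ≤ j → (ps : Vec (P 𝒫) j) →
    (k : ℕ) (ψ : Formula (ColoredPoset.colors 𝒫) k) (v : Vec (P 𝒫) k) →
    Reachable 𝒫 (pos j φ ps) (pos k ψ v) → j < k →
    (i : Fin k) → j ≤ toℕ i →
    R 𝒫 (q ∸ 1) (r (q ∸ 1)) (_∈ ps) (lookup v i)
lemma4p1 𝒫 q j φ qrφ≡q j≥1 ps k ψ v play _ i _ =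
  reach-mono (m∸n≤m (r Q) (r⁻ (qr ψ))) (Inv.within final (lookup v i) (∈-lookup i v))
  where
  open Locality 𝒫 q ps
  open Reachability 𝒫

  initial : Inv (pos j φ ps)
  initial = inv (≤-reflexive qrφ≡q) j≥1 (λ x x∈ps → here x∈ps)

  final : Inv (pos k ψ v)
  final = preserve⋆ play initial
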